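{- Let $q\ge2$, $n\ge0$ be integers and let $G$ be a symmetric $q\times q$ complex matrix ($G=G^T$). Then for all $p,s\in V(n,q)$, \[ MG(s;p)=\frac{p!}{s!}\,MG(p;s). \]
   Context: For integers $n\ge0$, $q\ge2$, $V(n,q)=\{p=(p_0,\ldots,p_{q-1})\in\mathbb{N}_0^q : \sum_i p_i=n\}$, and $p!=\prod_{i}p_i!$. Entries of $G$ are $g_{ij}$, $i,j=0,\ldots,q-1$. For $p,s\in V(n,q)$, \[ MG(p;s)=s!\sum_{(r_{i,j})}\prod_{a=0}^{q-1}\prod_{b=0}^{q-1}\frac{g_{ab}^{r_{a,b}}}{r_{a,b}!}, \] the sum being over all families of nonnegative integers $r_{i,j}$ ($i,j=0,\ldots,q-1$) with $\sum_j r_{i,j}=s_i$ for all $i$ and $\sum_i r_{i,j}=p_j$ for all $j$ (with $0^0=1$). -}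

module Defs where

open import Level using (Level)
open import Data.Nat using (ℕ; zero; suc; _+_; _*_; _/_; _!; NonZero)
open import Data.Nat.Properties using (m*n≢0; _!≢0)
open import Relation.Binary.PropositionalEquality using (_≡_)
open import Data.Fin using (Fin; zero; suc)
open import Data.List using (List; []; _∷_; map; concatMap; upTo)
open import Data.Bool using (Bool; true; false; if_then_else_; _∧_)
open import Data.Nat using (_≡ᵇ_)
open import Algebra.Bundles using (CommutativeRing)

sumℕ : (k : ℕ) → (Fin k → ℕ) → ℕ
sumℕ zero    f = 0
sumℕ (suc k) f = f zero + sumℕ k (λ i → f (suc i))

prodℕ : (k : ℕ) → (Fin k → ℕ) → ℕ
prodℕ zero    f = 1
prodℕ (suc k) f = f zero * prodℕ k (λ i → f (suc i))

InV : (n q : ℕ) → (Fin q → ℕ) → Set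
InV n q p = sumℕ q p ≡ n

fact : (q : ℕ) → (Fin q → ℕ) → ℕ
fact q p = prodℕ q (λ i → p i !)

prodFact≢0 : (k : ℕ) (f : Fin k → ℕ) → NonZero (prodℕ k (λ i → f i !))
prodFact≢0 zero    f = _
prodFact≢0 (suc k) f =
  m*n≢0 (f zero !) (prodℕ k (λ i → f (suc i) !)) {{f zero !≢0}} {{prodFact≢0 k (λ i → f (suc i))}}

matFact : (q : ℕ) → (Fin q → Fin q → ℕ) → ℕ
matFact q r = prodℕ q (λ a → fact q (r a))

matFact≢0 : (q : ℕ) (r : Fin q → Fin q → ℕ) → NonZero (matFact q r)
matFact≢0 zero    r = _
matFact≢0 (suc q) r =
  m*n≢0 (fact (suc q) (r zero)) (prodℕ q (λ a → fact (suc q) (r (suc a))))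
    {{prodFact≢0 (suc q) (r zero)}} {{matFact≢0' q (λ a → r (suc a))}}
  where
  matFact≢0' : (k : ℕ) (r' : Fin k → Fin (suc q) → ℕ) → NonZero (prodℕ k (λ a → fact (suc q) (r' a)))
  matFact≢0' zero    r' = _
  matFact≢0' (suc k) r' =
    m*n≢0 (fact (suc q) (r' zero)) (prodℕ k (λ a → fact (suc q) (r' (suc a))))
      {{prodFact≢0 (suc q) (r' zero)}} {{matFact≢0' k (λ a → r' (suc a))}}

coeff : (q : ℕ) → (s : Fin q → ℕ) → (Fin q → Fin q → ℕ) → ℕ
coeff q s r = (fact q s / matFact q r) {{matFact≢0 q r}}

allFuns : {a : Level} {A : Set a} (k : ℕ) → (Fin k → List A) → List (Fin k → A)
allFuns zero    L = (λ ()) ∷ []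
allFuns (suc k) L =
  concatMap (λ x → map (λ f → λ { zero → x ; (suc i) → f i }) (allFuns k (λ i → L (suc i)))) (L zero)

-- All q×q matrices r of naturals with 0 ≤ r_{a,b} ≤ s_a (a superset of the
-- matrices with row sums s).
candidates : (q : ℕ) → (s : Fin q → ℕ) → List (Fin q → Fin q → ℕ)
candidates q s = allFuns q (λ a → allFuns q (λ b → upTo (suc (s a))))

allEqᵇ : (k : ℕ) → (Fin k → ℕ) → (Fin k → ℕ) → Bool
allEqᵇ zero    f g = true
allEqᵇ (suc k) f g = (f zero ≡ᵇ g zero) ∧ allEqᵇ k (λ i → f (suc i)) (λ i → g (suc i))

admissibleᵇ : (q : ℕ) → (p s : Fin q → ℕ) → (Fin q → Fin q → ℕ) → Bool
admissibleᵇ q p s r =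
  allEqᵇ q (λ i → sumℕ q (λ j → r i j)) s ∧ allEqᵇ q (λ j → sumℕ q (λ i → r i j)) p

module _ {c ℓ : Level} (R : CommutativeRing c ℓ) where
  open CommutativeRing R using (Carrier; 0#; 1#) renaming (_+_ to _+R_; _*_ to _*R_)

  pow : Carrier → ℕ → Carrier
  pow x zero    = 1#
  pow x (suc m) = x *R pow x m

  _·_ : ℕ → Carrier → Carrier
  zero  · x = 0#
  suc m · x = x +R m · x

  sumR : List Carrier → Carrier
  sumR []       = 0#
  sumR (x ∷ xs) = x +R sumR xs

  prodR : (k : ℕ) → (Fin k → Carrier) → Carrier
  prodR zero    f = 1#
  prodR (suc k) f = f zero *R prodR k (λ i → f (suc i))

  -- MG(p;s) = s! ∑_{r} ∏_{a,b} g_{ab}^{r_{ab}} / r_{ab}!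
  --         = ∑_{r} (s!/r!) · ∏_{a,b} g_{ab}^{r_{ab}}   (s!/r! is an integer)
  MG : (q : ℕ) → (G : Fin q → Fin q → Carrier) → (p s : Fin q → ℕ) → Carrier
  MG q G p s = sumR (map term (candidates q s))
    where
    term : (Fin q → Fin q → ℕ) → Carrier
    term r = if admissibleᵇ q p s r
             then coeff q s r · prodR q (λ a → prodR q (λ b → pow (G a b) (r a b)))
             else 0#

module Submission where

-- A matrix r with column sums p and row sums s contributes (s!/r!) ∏ g_ab^r_ab to MG(p;s),
-- where r! = ∏ r_ab!.  Transposition maps the matrices indexing MG(s;p) bijectively onto
-- those indexing MG(p;s); it preserves r!, and preserves the monomial because G is
-- symmetric.  So s! times the summand of r in MG(s;p) and p! times the summand of rᵀ in
-- MG(p;s) are both (p! s! / r!) ∏ g_ab^r_ab.  Since MG sums over all matrices with entries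
-- bounded by the row sums and discards the inadmissible ones, the two sums range over
-- different lists, which are compared as duplicate-free lists with the same admissible
-- elements.

open import Defs
open import Level using (Level)
open import Data.Nat using (ℕ; _≥_)
open import Data.Fin using (Fin)
open import Algebra.Bundles using (CommutativeRing)

import Algebra.Properties.CommutativeMonoid.Sum as CommutativeMonoidSum
open import Data.Bool using (true; false; T; if_then_else_; _∧_)
open import Data.Bool.Properties using (∧-comm; T-∧)
open import Data.Empty using (⊥-elim)
open import Data.Fin using (zero; suc)
open import Data.List using (List; []; _∷_; map; concatMap)
open import Data.List.Properties using (map-∘)
open import Data.List.Membership.Propositional.Properties using (∈-upTo⁺)
import Data.List.Membership.Setoid as Membership
open import Data.List.Membership.Setoid.Properties using (∈-resp-≈; All[≉]⇒∉)
open import Data.List.Relation.Binary.Disjoint.Setoid using (Disjoint)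
open import Data.List.Relation.Unary.All using ([]; universal)
import Data.List.Relation.Unary.All.Properties as All
open import Data.List.Relation.Unary.AllPairs using ([]; _∷_)
import Data.List.Relation.Unary.AllPairs as AllPairs
import Data.List.Relation.Unary.AllPairs.Properties as AllPairs
open import Data.List.Relation.Unary.Any using (here; there; _─_; satisfied)
import Data.List.Relation.Unary.Any as Any
import Data.List.Relation.Unary.Any.Properties as Any
open import Data.List.Relation.Unary.Unique.Propositional.Properties using (upTo⁺)
import Data.List.Relation.Unary.Unique.Setoid as UniqueSetoid
import Data.List.Relation.Unary.Unique.Setoid.Properties as Unique
import Data.Nat as ℕ
open import Data.Nat using (zero; suc; _≤_; _!; NonZero; s≤s; _≡ᵇ_)
open import Data.Nat.Combinatorics using (k![n∸k]!∣n!)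
open import Data.Nat.Divisibility using (_∣_; ∣-refl; ∣-trans; *-pres-∣; *-monoʳ-∣)
open import Data.Nat.DivMod using (_/_; *-/-assoc)
import Data.Nat.Properties as ℕ
open import Data.Product using (_,_; proj₁; proj₂)
open import Data.Vec.Functional using (Vector)
import Data.Vec.Functional.Relation.Binary.Equality.Setoid as VecEq
open import Function using (_∘_; Equivalence)
open import Relation.Binary.Bundles using (Setoid)
open import Relation.Binary.Definitions using (_Respects_)
open import Relation.Binary.PropositionalEquality as ≡ using (_≡_; cong; cong₂)
open import Relation.Nullary using (¬_; yes; no)
open import Relation.Nullary.Decidable using (T?)
open import Relation.Unary using (Pred; Decidable)

module AllFuns {a ℓ} (S : Setoid a ℓ) where
  open Setoid S renaming (Carrier to A)
  open VecEq S using (_≋_; ≋-setoid)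
  open Membership S using (_∈_)
  open UniqueSetoid S using (Unique)

  _∈ᵥ_ : ∀ {k} → Vector A k → List (Vector A k) → Set _
  _∈ᵥ_ {k} = Membership._∈_ (≋-setoid k)

  Uniqueᵥ : ∀ {k} → List (Vector A k) → Set _
  Uniqueᵥ {k} = UniqueSetoid.Unique (≋-setoid k)

  -- The cons in `allFuns` is a pattern lambda, to which no other term is
  -- definitionally equal, so these lemmas abstract over it.
  module _ {k} (c : A → Vector A k → Vector A (suc k))
           (c-head : ∀ x g → c x g zero ≈ x) (c-tail : ∀ x g i → c x g (suc i) ≈ g i) where

    ∈-concatMap-cons : ∀ {f xs G} → f zero ∈ xs → (f ∘ suc) ∈ᵥ G →
                       f ∈ᵥ concatMap (λ x → map (c x) G) xs
    ∈-concatMap-cons {f} f₀∈xs f₊∈G =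
      Any.concat⁺ (Any.map⁺ (Any.map (λ f₀≈x → Any.map⁺ (Any.map (f≋cons f₀≈x) f₊∈G)) f₀∈xs))
      where
      f≋cons : ∀ {x g} → f zero ≈ x → (f ∘ suc) ≋ g → f ≋ c x g
      f≋cons f₀≈x f₊≋g zero    = trans f₀≈x (sym (c-head _ _))
      f≋cons f₀≈x f₊≋g (suc i) = trans (f₊≋g i) (sym (c-tail _ _ i))

    head-∈-map-cons : ∀ {v x G} → v ∈ᵥ map (c x) G → v zero ≈ x
    head-∈-map-cons v∈ with g , v≋cxg ← satisfied (Any.map⁻ v∈) = trans (v≋cxg zero) (c-head _ g)

    concatMap-cons-unique : ∀ {xs G} → Unique xs → Uniqueᵥ G →
                            Uniqueᵥ (concatMap (λ x → map (c x) G) xs)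
    concatMap-cons-unique {xs} xs! G! = Unique.concat⁺ (≋-setoid (suc k))
      (All.map⁺ (universal (λ x → Unique.map⁺ (≋-setoid k) (≋-setoid (suc k)) (cons-injective x) G!) xs))
      (AllPairs.map⁺ (AllPairs.map disjoint xs!))
      where
      cons-injective : ∀ x {g g'} → c x g ≋ c x g' → g ≋ g'
      cons-injective x e i = trans (sym (c-tail x _ i)) (trans (e (suc i)) (c-tail x _ i))
      disjoint : ∀ {x y} {G} → ¬ x ≈ y → Disjoint (≋-setoid (suc k)) (map (c x) G) (map (c y) G)
      disjoint x≉y (v∈x , v∈y) = x≉y (trans (sym (head-∈-map-cons v∈x)) (head-∈-map-cons v∈y))

  ∈-allFuns : ∀ k (L : Fin k → List A) {f} → (∀ i → f i ∈ L i) → f ∈ᵥ allFuns k L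
  ∈-allFuns zero    L f∈L = here (λ ())
  ∈-allFuns (suc k) L f∈L = ∈-concatMap-cons _ (λ _ _ → refl) (λ _ _ _ → refl)
    (f∈L zero) (∈-allFuns k (L ∘ suc) (f∈L ∘ suc))

  allFuns-unique : ∀ k (L : Fin k → List A) → (∀ i → Unique (L i)) → Uniqueᵥ (allFuns k L)
  allFuns-unique zero    L L! = [] ∷ []
  allFuns-unique (suc k) L L! = concatMap-cons-unique _ (λ _ _ → refl) (λ _ _ _ → refl)
    (L! zero) (allFuns-unique k (L ∘ suc) (L! ∘ suc))

sumℕ-cong : ∀ k {f g : Fin k → ℕ} → (∀ i → f i ≡ g i) → sumℕ k f ≡ sumℕ k g
sumℕ-cong zero    f≗g = ≡.refl
sumℕ-cong (suc k) f≗g = cong₂ ℕ._+_ (f≗g zero) (sumℕ-cong k (f≗g ∘ suc))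

prodℕ-cong : ∀ k {f g : Fin k → ℕ} → (∀ i → f i ≡ g i) → prodℕ k f ≡ prodℕ k g
prodℕ-cong zero    f≗g = ≡.refl
prodℕ-cong (suc k) f≗g = cong₂ ℕ._*_ (f≗g zero) (prodℕ-cong k (f≗g ∘ suc))

≤-sumℕ : ∀ k (f : Fin k → ℕ) i → f i ≤ sumℕ k f
≤-sumℕ (suc k) f zero    = ℕ.m≤m+n (f zero) _
≤-sumℕ (suc k) f (suc i) = ℕ.≤-trans (≤-sumℕ k (f ∘ suc) i) (ℕ.m≤n+m _ (f zero))

prodℕ-∣ : ∀ k {f g : Fin k → ℕ} → (∀ i → f i ∣ g i) → prodℕ k f ∣ prodℕ k g
prodℕ-∣ zero    f∣g = ∣-refl
prodℕ-∣ (suc k) f∣g = *-pres-∣ (f∣g zero) (prodℕ-∣ k (f∣g ∘ suc))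

fact-∣-sumℕ! : ∀ k (f : Fin k → ℕ) → fact k f ∣ sumℕ k f !
fact-∣-sumℕ! zero    f = ∣-refl
fact-∣-sumℕ! (suc k) f = ∣-trans (*-monoʳ-∣ (f zero !) (fact-∣-sumℕ! k (f ∘ suc)))
  (≡.subst (λ m → f zero ! ℕ.* m ! ∣ (f zero ℕ.+ rest) !) (ℕ.m+n∸m≡n (f zero) rest)
     (k![n∸k]!∣n! (ℕ.m≤m+n (f zero) rest)))
  where rest = sumℕ k (f ∘ suc)

module ℕ∏ = CommutativeMonoidSum ℕ.*-1-commutativeMonoid

prodℕ≡product : ∀ k (f : Fin k → ℕ) → prodℕ k f ≡ ℕ∏.sum f
prodℕ≡product zero    f = ≡.refl
prodℕ≡product (suc k) f = cong (f zero ℕ.*_) (prodℕ≡product k (f ∘ suc))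

prodℕ-comm : ∀ k m (f : Fin k → Fin m → ℕ) →
             prodℕ k (λ a → prodℕ m (f a)) ≡ prodℕ m (λ b → prodℕ k (λ a → f a b))
prodℕ-comm k m f = begin
  prodℕ k (λ a → prodℕ m (f a))            ≡⟨ prodℕ-cong k (λ a → prodℕ≡product m (f a)) ⟩
  prodℕ k (λ a → ℕ∏.sum (f a))             ≡⟨ prodℕ≡product k _ ⟩
  ℕ∏.sum (λ a → ℕ∏.sum (f a))              ≡⟨ ℕ∏.∑-comm f ⟩
  ℕ∏.sum (λ b → ℕ∏.sum (λ a → f a b))      ≡⟨ prodℕ≡product m _ ⟨
  prodℕ m (λ b → ℕ∏.sum (λ a → f a b))     ≡⟨ prodℕ-cong m (λ b → prodℕ≡product k (λ a → f a b)) ⟨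
  prodℕ m (λ b → prodℕ k (λ a → f a b))    ∎
  where open ≡.≡-Reasoning

/-congʳ : ∀ m {n o} .{{_ : NonZero n}} .{{_ : NonZero o}} → n ≡ o → m / n ≡ m / o
/-congʳ m ≡.refl = ≡.refl

allEqᵇ-sound : ∀ k {f g : Fin k → ℕ} → T (allEqᵇ k f g) → ∀ i → f i ≡ g i
allEqᵇ-sound (suc k) {f} {g} f≡g zero    = ℕ.≡ᵇ⇒≡ (f zero) (g zero) (proj₁ (Equivalence.to T-∧ f≡g))
allEqᵇ-sound (suc k) {f} {g} f≡g (suc i) =
  allEqᵇ-sound k (proj₂ (Equivalence.to (T-∧ {f zero ≡ᵇ g zero}) f≡g)) i

allEqᵇ-congˡ : ∀ k {f f' : Fin k → ℕ} g → (∀ i → f i ≡ f' i) → allEqᵇ k f g ≡ allEqᵇ k f' g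
allEqᵇ-congˡ zero    g f≗f' = ≡.refl
allEqᵇ-congˡ (suc k) g f≗f' = cong₂ _∧_ (cong (_≡ᵇ g zero) (f≗f' zero)) (allEqᵇ-congˡ k (g ∘ suc) (f≗f' ∘ suc))

Matrix : ℕ → Set
Matrix q = Fin q → Fin q → ℕ

transpose : ∀ {q} → Matrix q → Matrix q
transpose r a b = r b a

HasRowSums : ∀ {q} → Matrix q → (Fin q → ℕ) → Set
HasRowSums {q} r s = ∀ a → sumℕ q (r a) ≡ s a

MatrixSetoid : ℕ → Setoid _ _
MatrixSetoid q = VecEq.≋-setoid (VecEq.≋-setoid (≡.setoid ℕ) q) q

module _ {q : ℕ} where
  open Setoid (MatrixSetoid q) using (_≈_)
  open Membership (MatrixSetoid q) using (_∈_)
  open UniqueSetoid (MatrixSetoid q) using (Unique)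

  matFact-∣-fact : ∀ (r : Matrix q) {s} → HasRowSums r s → matFact q r ∣ fact q s
  matFact-∣-fact r rows = prodℕ-∣ q (λ a → ≡.subst (λ m → fact q (r a) ∣ m !) (rows a) (fact-∣-sumℕ! q (r a)))

  matFact-transpose : ∀ (r : Matrix q) → matFact q (transpose r) ≡ matFact q r
  matFact-transpose r = prodℕ-comm q q (λ a b → r b a !)

  coeff-cong : ∀ s {r r'} → r ≈ r' → coeff q s r ≡ coeff q s r'
  coeff-cong s {r} {r'} r≈r' = /-congʳ (fact q s) (prodℕ-cong q (λ a → prodℕ-cong q (λ b → cong _! (r≈r' a b))))
    where instance _ = matFact≢0 q r ; _ = matFact≢0 q r'

  -- both sides equal p! s! / r!
  coeff-transpose : ∀ (r : Matrix q) {p s} → HasRowSums r p → HasRowSums (transpose r) s →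
                    fact q s ℕ.* coeff q p r ≡ fact q p ℕ.* coeff q s (transpose r)
  coeff-transpose r {p} {s} rows cols = begin
    fact q s ℕ.* (fact q p / matFact q r)               ≡⟨ *-/-assoc (fact q s) (matFact-∣-fact r rows) ⟨
    fact q s ℕ.* fact q p / matFact q r                 ≡⟨ cong (λ m → m / matFact q r) (ℕ.*-comm (fact q s) (fact q p)) ⟩
    fact q p ℕ.* fact q s / matFact q r                 ≡⟨ /-congʳ (fact q p ℕ.* fact q s) (matFact-transpose r) ⟨
    fact q p ℕ.* fact q s / matFact q (transpose r)     ≡⟨ *-/-assoc (fact q p) (matFact-∣-fact (transpose r) cols) ⟩
    fact q p ℕ.* (fact q s / matFact q (transpose r))   ∎
    where
    open ≡.≡-Reasoning
    instance
      _ = matFact≢0 q r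
      _ = matFact≢0 q (transpose r)

  ∈-candidates : ∀ (r : Matrix q) {s} → HasRowSums r s → r ∈ candidates q s
  ∈-candidates r rows = AllFuns.∈-allFuns (VecEq.≋-setoid (≡.setoid ℕ) q) q _
    (λ a → AllFuns.∈-allFuns (≡.setoid ℕ) q _
      (λ b → ∈-upTo⁺ (s≤s (≡.subst (r a b ≤_) (rows a) (≤-sumℕ q (r a) b)))))

  candidates-unique : ∀ s → Unique (candidates q s)
  candidates-unique s = AllFuns.allFuns-unique (VecEq.≋-setoid (≡.setoid ℕ) q) q _
    (λ a → AllFuns.allFuns-unique (≡.setoid ℕ) q _ (λ b → upTo⁺ (suc (s a))))

  transpose-candidates-unique : ∀ s → Unique (map transpose (candidates q s))
  transpose-candidates-unique s =
    Unique.map⁺ (MatrixSetoid q) (MatrixSetoid q) (λ e a b → e b a) (candidates-unique s)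

  module _ {p s : Fin q → ℕ} where

    admissible⇒rowSums : ∀ {r} → T (admissibleᵇ q p s r) → HasRowSums r s
    admissible⇒rowSums adm = allEqᵇ-sound q (proj₁ (Equivalence.to T-∧ adm))

    admissible⇒colSums : ∀ {r} → T (admissibleᵇ q p s r) → HasRowSums (transpose r) p
    admissible⇒colSums {r} adm =
      allEqᵇ-sound q (proj₂ (Equivalence.to (T-∧ {allEqᵇ q (λ a → sumℕ q (r a)) s}) adm))

    admissibleᵇ-transpose : ∀ r → admissibleᵇ q s p (transpose r) ≡ admissibleᵇ q p s r
    admissibleᵇ-transpose r = ∧-comm (allEqᵇ q (λ b → sumℕ q (λ a → r a b)) p) (allEqᵇ q (λ a → sumℕ q (r a)) s)

    admissibleᵇ-cong : ∀ {r r'} → r ≈ r' → admissibleᵇ q p s r ≡ admissibleᵇ q p s r'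
    admissibleᵇ-cong r≈r' = cong₂ _∧_ (allEqᵇ-congˡ q s (λ a → sumℕ-cong q (r≈r' a)))
                                      (allEqᵇ-congˡ q p (λ b → sumℕ-cong q (λ a → r≈r' a b)))

module RingProperties {c ℓ} (R : CommutativeRing c ℓ) where
  open CommutativeRing R hiding (zero)
  open import Algebra.Properties.CommutativeSemigroup +-commutativeSemigroup using (interchange; x∙yz≈y∙xz)
  open import Relation.Binary.Reasoning.Setoid setoid

  infixr 8 _×_
  _×_ : ℕ → Carrier → Carrier
  _×_ = _·_ R

  ×-congʳ : ∀ n {x y} → x ≈ y → n × x ≈ n × y
  ×-congʳ zero    x≈y = refl
  ×-congʳ (suc n) x≈y = +-cong x≈y (×-congʳ n x≈y)

  ×-zeroʳ : ∀ n → n × 0# ≈ 0#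
  ×-zeroʳ zero    = refl
  ×-zeroʳ (suc n) = trans (+-identityˡ _) (×-zeroʳ n)

  ×-distrib-+ : ∀ n x y → n × (x + y) ≈ n × x + n × y
  ×-distrib-+ zero    x y = sym (+-identityˡ 0#)
  ×-distrib-+ (suc n) x y = trans (+-congˡ (×-distrib-+ n x y)) (interchange x y (n × x) (n × y))

  ×-homo-+ : ∀ m n x → (m ℕ.+ n) × x ≈ m × x + n × x
  ×-homo-+ zero    n x = sym (+-identityˡ _)
  ×-homo-+ (suc m) n x = trans (+-congˡ (×-homo-+ m n x)) (sym (+-assoc _ _ _))

  ×-assocˡ : ∀ m n x → m × n × x ≈ (m ℕ.* n) × x
  ×-assocˡ zero    n x = refl
  ×-assocˡ (suc m) n x = trans (+-congˡ (×-assocˡ m n x)) (sym (×-homo-+ n (m ℕ.* n) x))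

  sumR-cong : ∀ {a} {A : Set a} {f g : A → Carrier} → (∀ x → f x ≈ g x) → ∀ xs →
              sumR R (map f xs) ≈ sumR R (map g xs)
  sumR-cong f≈g []       = refl
  sumR-cong f≈g (x ∷ xs) = +-cong (f≈g x) (sumR-cong f≈g xs)

  ×-sumR : ∀ n {a} {A : Set a} (f : A → Carrier) xs → n × sumR R (map f xs) ≈ sumR R (map (λ x → n × f x) xs)
  ×-sumR n f []       = ×-zeroʳ n
  ×-sumR n f (x ∷ xs) = trans (×-distrib-+ n _ _) (+-congˡ (×-sumR n f xs))

  pow-cong : ∀ {x y} n → x ≈ y → pow R x n ≈ pow R y n
  pow-cong zero    x≈y = refl
  pow-cong (suc n) x≈y = *-cong x≈y (pow-cong n x≈y)

  prodR-cong : ∀ k {f g : Fin k → Carrier} → (∀ i → f i ≈ g i) → prodR R k f ≈ prodR R k g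
  prodR-cong zero    f≈g = refl
  prodR-cong (suc k) f≈g = *-cong (f≈g zero) (prodR-cong k (f≈g ∘ suc))

  module ∏ = CommutativeMonoidSum *-commutativeMonoid

  prodR≡product : ∀ k (f : Fin k → Carrier) → prodR R k f ≡ ∏.sum f
  prodR≡product zero    f = ≡.refl
  prodR≡product (suc k) f = cong (f zero *_) (prodR≡product k (f ∘ suc))

  prodR-comm : ∀ k m (f : Fin k → Fin m → Carrier) →
               prodR R k (λ a → prodR R m (f a)) ≈ prodR R m (λ b → prodR R k (λ a → f a b))
  prodR-comm k m f = begin
    prodR R k (λ a → prodR R m (f a))            ≈⟨ prodR-cong k (λ a → reflexive (prodR≡product m (f a))) ⟩
    prodR R k (λ a → ∏.sum (f a))                ≡⟨ prodR≡product k _ ⟩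
    ∏.sum (λ a → ∏.sum (f a))                    ≈⟨ ∏.∑-comm f ⟩
    ∏.sum (λ b → ∏.sum (λ a → f a b))            ≡⟨ prodR≡product m _ ⟨
    prodR R m (λ b → ∏.sum (λ a → f a b))        ≈⟨ prodR-cong m (λ b → reflexive (prodR≡product k (λ a → f a b))) ⟨
    prodR R m (λ b → prodR R k (λ a → f a b))    ∎

  ×-if : ∀ m n {b b' x y} → b ≡ b' → (T b → m × x ≈ n × y) →
         m × (if b then x else 0#) ≈ n × (if b' then y else 0#)
  ×-if m n {true}  ≡.refl x≈y = x≈y _
  ×-if m n {false} ≡.refl x≈y = trans (×-zeroʳ m) (sym (×-zeroʳ n))

  if-cong : ∀ {b b' x y} → b ≡ b' → (T b → x ≈ y) → (if b then x else 0#) ≈ (if b' then y else 0#)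
  if-cong {true}  ≡.refl x≈y = x≈y _
  if-cong {false} ≡.refl x≈y = refl

  if-false : ∀ b {x} → ¬ T b → (if b then x else 0#) ≈ 0#
  if-false true  ¬b = ⊥-elim (¬b _)
  if-false false ¬b = refl

  module _ {a e} (S : Setoid a e) where
    open Setoid S using () renaming (Carrier to A; _≈_ to _≐_; refl to ≐-refl; sym to ≐-sym; trans to ≐-trans)
    open Membership S using (_∈_; _∉_)
    open UniqueSetoid S using (Unique)

    ∈-─⁻ : ∀ {xs x y} (x∈xs : x ∈ xs) → y ∈ (xs ─ x∈xs) → y ∈ xs
    ∈-─⁻ (here _)    y∈          = there y∈
    ∈-─⁻ (there x∈)  (here y≐z)  = here y≐z
    ∈-─⁻ (there x∈)  (there y∈)  = there (∈-─⁻ x∈ y∈)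

    ∈-─⁺ : ∀ {xs x y} (x∈xs : x ∈ xs) → y ∈ xs → ¬ y ≐ x → y ∈ (xs ─ x∈xs)
    ∈-─⁺ (here x≐z)  (here y≐z)  y≉x = ⊥-elim (y≉x (≐-trans y≐z (≐-sym x≐z)))
    ∈-─⁺ (here _)    (there y∈)  _   = y∈
    ∈-─⁺ (there _)   (here y≐z)  _   = here y≐z
    ∈-─⁺ (there x∈)  (there y∈)  y≉x = there (∈-─⁺ x∈ y∈ y≉x)

    Unique-─ : ∀ {xs x} (x∈xs : x ∈ xs) → Unique xs → Unique (xs ─ x∈xs)
    Unique-─ (here _)   (_ ∷ xs!)     = xs!
    Unique-─ (there x∈) (z≉xs ∷ xs!)  = All.─⁺ x∈ z≉xs ∷ Unique-─ x∈ xs!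

    ∉-─ : ∀ {xs x} (x∈xs : x ∈ xs) → Unique xs → x ∉ (xs ─ x∈xs)
    ∉-─ (here x≐z)  (z≉xs ∷ _)  x∈          = All[≉]⇒∉ S z≉xs (∈-resp-≈ S x≐z x∈)
    ∉-─ (there x∈)  (z≉xs ∷ _)  (here x≐z)  = All[≉]⇒∉ S z≉xs (∈-resp-≈ S x≐z x∈)
    ∉-─ (there x∈)  (_ ∷ xs!)   (there x∈') = ∉-─ x∈ xs! x∈'

    module _ (h : A → Carrier) (h-cong : ∀ {x y} → x ≐ y → h x ≈ h y) where

      Σh : List A → Carrier
      Σh xs = sumR R (map h xs)

      sumR-─ : ∀ {xs x} (x∈xs : x ∈ xs) → Σh xs ≈ h x + Σh (xs ─ x∈xs)
      sumR-─ (here x≐z)            = +-congʳ (h-cong (≐-sym x≐z))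
      sumR-─ {z ∷ xs} {x} (there x∈) = begin
        h z + Σh xs                ≈⟨ +-congˡ (sumR-─ x∈) ⟩
        h z + (h x + Σh (xs ─ x∈)) ≈⟨ x∙yz≈y∙xz (h z) (h x) _ ⟩
        h x + (h z + Σh (xs ─ x∈)) ∎

      module _ {p} {P : Pred A p} (P? : Decidable P) (P-resp : P Respects _≐_)
               (h-vanishes : ∀ {x} → ¬ P x → h x ≈ 0#) where

        sumR-vanishing : ∀ {xs} → (∀ {y} → P y → y ∉ xs) → Σh xs ≈ 0#
        sumR-vanishing {[]}     _   = refl
        sumR-vanishing {x ∷ xs} P∉ = trans
          (+-cong (h-vanishes (λ Px → P∉ Px (here ≐-refl))) (sumR-vanishing (λ Py → P∉ Py ∘ there)))
          (+-identityˡ 0#)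

        sumR-reindex : ∀ {xs ys} → Unique xs → Unique ys →
                       (∀ {y} → P y → y ∈ xs → y ∈ ys) → (∀ {y} → P y → y ∈ ys → y ∈ xs) →
                       Σh xs ≈ Σh ys
        sumR-reindex {[]} _ _ _ ys⊆xs = sym (sumR-vanishing (λ Py → Any.¬Any[] ∘ ys⊆xs Py))
        sumR-reindex {x ∷ xs} {ys} (x≉xs ∷ xs!) ys! xs⊆ys ys⊆xs with P? x
        ... | no ¬Px = begin
          h x + Σh xs  ≈⟨ +-congʳ (h-vanishes ¬Px) ⟩
          0# + Σh xs   ≈⟨ +-identityˡ _ ⟩
          Σh xs        ≈⟨ sumR-reindex xs! ys! (λ Py → xs⊆ys Py ∘ there) ys⊆xs′ ⟩
          Σh ys        ∎
          where
          ys⊆xs′ : ∀ {y} → P y → y ∈ ys → y ∈ xs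
          ys⊆xs′ Py y∈ys with ys⊆xs Py y∈ys
          ... | here y≐x   = ⊥-elim (¬Px (P-resp y≐x Py))
          ... | there y∈xs = y∈xs
        ... | yes Px = begin
          h x + Σh xs           ≈⟨ +-congˡ (sumR-reindex xs! (Unique-─ x∈ys ys!) xs⊆ys′ ys⊆xs′) ⟩
          h x + Σh (ys ─ x∈ys)  ≈⟨ sumR-─ x∈ys ⟨
          Σh ys                 ∎
          where
          x∈ys : x ∈ ys
          x∈ys = xs⊆ys Px (here ≐-refl)
          xs⊆ys′ : ∀ {y} → P y → y ∈ xs → y ∈ (ys ─ x∈ys)
          xs⊆ys′ Py y∈xs = ∈-─⁺ x∈ys (xs⊆ys Py (there y∈xs))
            (λ y≐x → All[≉]⇒∉ S x≉xs (∈-resp-≈ S y≐x y∈xs))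
          ys⊆xs′ : ∀ {y} → P y → y ∈ (ys ─ x∈ys) → y ∈ xs
          ys⊆xs′ Py y∈ with ys⊆xs Py (∈-─⁻ x∈ys y∈)
          ... | here y≐x   = ⊥-elim (∉-─ x∈ys ys! (∈-resp-≈ S y≐x y∈))
          ... | there y∈xs = y∈xs

  module _ {q : ℕ} (G : Fin q → Fin q → Carrier) where
    open Setoid (MatrixSetoid q) using () renaming (_≈_ to _≋_)

    monomial : Matrix q → Carrier
    monomial r = prodR R q (λ a → prodR R q (λ b → pow R (G a b) (r a b)))

    -- literally the summand in the definition of MG, so that MG R q G p s unfolds
    -- to sumR R (map (summand p s) (candidates q s))
    summand : (p s : Fin q → ℕ) → Matrix q → Carrier
    summand p s r = if admissibleᵇ q p s r then coeff q s r × monomial r else 0#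

    monomial-cong : ∀ {r r'} → r ≋ r' → monomial r ≈ monomial r'
    monomial-cong r≋r' = prodR-cong q (λ a → prodR-cong q (λ b → reflexive (cong (pow R (G a b)) (r≋r' a b))))

    monomial-transpose : (∀ a b → G a b ≈ G b a) → ∀ r → monomial (transpose r) ≈ monomial r
    monomial-transpose G-sym r = trans (prodR-comm q q (λ a b → pow R (G a b) (r b a)))
      (prodR-cong q (λ b → prodR-cong q (λ a → pow-cong (r b a) (G-sym a b))))

    module _ {p s : Fin q → ℕ} where

      summand-cong : ∀ {r r'} → r ≋ r' → summand p s r ≈ summand p s r'
      summand-cong {r} {r'} r≋r' = if-cong (admissibleᵇ-cong r≋r') λ _ →
        trans (reflexive (cong (_× monomial r) (coeff-cong s r≋r'))) (×-congʳ (coeff q s r') (monomial-cong r≋r'))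

      summand-transpose : (∀ a b → G a b ≈ G b a) → ∀ r →
                          fact q s × summand s p r ≈ fact q p × summand p s (transpose r)
      summand-transpose G-sym r =
        ×-if (fact q s) (fact q p) {admissibleᵇ q s p r} (admissibleᵇ-transpose (transpose r)) λ adm → begin
          fact q s × coeff q p r × monomial r                       ≈⟨ ×-assocˡ (fact q s) _ _ ⟩
          (fact q s ℕ.* coeff q p r) × monomial r                   ≡⟨ cong (_× monomial r) (coefficients adm) ⟩
          (fact q p ℕ.* coeff q s rᵀ) × monomial r                  ≈⟨ ×-congʳ (fact q p ℕ.* coeff q s rᵀ) (monomial-transpose G-sym r) ⟨
          (fact q p ℕ.* coeff q s rᵀ) × monomial rᵀ                 ≈⟨ ×-assocˡ (fact q p) _ _ ⟨
          fact q p × coeff q s rᵀ × monomial rᵀ                     ∎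
        where
        rᵀ = transpose r
        coefficients : T (admissibleᵇ q s p r) → fact q s ℕ.* coeff q p r ≡ fact q p ℕ.* coeff q s rᵀ
        coefficients adm = coeff-transpose r (admissible⇒rowSums {p = s} adm) (admissible⇒colSums {p = s} adm)

      sumR-summand-transpose-candidates : sumR R (map (summand p s) (map transpose (candidates q p))) ≈ MG R q G p s
      sumR-summand-transpose-candidates = sumR-reindex (MatrixSetoid q) (summand p s) summand-cong
        (T? ∘ admissibleᵇ q p s) (λ r≋r' → ≡.subst T (admissibleᵇ-cong r≋r'))
        (λ {r} → if-false (admissibleᵇ q p s r))
        (transpose-candidates-unique p) (candidates-unique s)
        (λ adm _ → ∈-candidates _ (admissible⇒rowSums adm))
        (λ adm _ → Any.map⁺ (Any.map (λ r≋r' a b → r≋r' b a) (∈-candidates _ (admissible⇒colSums adm))))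

mainTheorem3 : {c ℓ : Level} (R : CommutativeRing c ℓ) →
    let open CommutativeRing R in
    (q n : ℕ) → q ≥ 2 →
    (G : Fin q → Fin q → Carrier) → (∀ i j → G i j ≈ G j i) →
    (p s : Fin q → ℕ) → InV n q p → InV n q s →
    _·_ R (fact q s) (MG R q G s p) ≈ _·_ R (fact q p) (MG R q G p s)
mainTheorem3 R q _ _ G G-sym p s _ _ = begin
  fact q s × MG R q G s p
    ≈⟨ ×-sumR (fact q s) (summand G s p) (candidates q p) ⟩
  sumR R (map (λ r → fact q s × summand G s p r) (candidates q p))
    ≈⟨ sumR-cong (summand-transpose G G-sym) (candidates q p) ⟩
  sumR R (map (λ r → fact q p × summand G p s (transpose r)) (candidates q p))
    ≈⟨ ×-sumR (fact q p) (summand G p s ∘ transpose) (candidates q p) ⟨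
  fact q p × sumR R (map (summand G p s ∘ transpose) (candidates q p))
    ≡⟨ cong (λ xs → fact q p × sumR R xs) (map-∘ (candidates q p)) ⟩
  fact q p × sumR R (map (summand G p s) (map transpose (candidates q p)))
    ≈⟨ ×-congʳ (fact q p) (sumR-summand-transpose-candidates G) ⟩
  fact q p × MG R q G p s
    ∎
  where
  open CommutativeRing R
  open RingProperties R
  open import Relation.Binary.Reasoning.Setoid setoid
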